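{- For any connected graph $G$ of order $n\ge 3$, $\mathrm{edim}_f(G)=1$ if and only if $G$ is the path $P_n$.
   Context: All graphs are finite, simple, undirected; $d(u,w)$ is the length of a shortest $u$–$w$ path. For a vertex $v$ and an edge $e=xy$, $d(e,v)=\min\{d(x,v),d(y,v)\}$. For distinct edges $e_1,e_2$, $R_e\{e_1,e_2\}=\{v\in V(G): d(v,e_1)\neq d(v,e_2)\}$. For $g:V(G)\to\mathbb{R}$ and $U\subseteq V(G)$, $g(U)=\sum_{s\in U}g(s)$. A function $g:V(G)\to[0,1]$ is an edge resolving function of $G$ if $g(R_e\{e_1,e_2\})\ge1$ for all distinct edges $e_1,e_2\in E(G)$; the fractional edge dimension is $\mathrm{edim}_f(G)=\min\{g(V(G)): g\text{ is an edge resolving function of }G\}$.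
   Formalization: Edge resolving functions take rational values in [0,1] instead of real values, both where the fractional edge dimension is attained and where it is a lower bound. -}

module Defs where

open import Data.Nat as ℕ using (ℕ; zero; suc; _⊓_; _≡ᵇ_)
open import Data.Fin using (Fin; zero; suc; toℕ; _<_)
open import Data.Bool using (Bool; true; false; _∧_; _∨_; not; if_then_else_)
open import Data.Rational as ℚ using (ℚ; 0ℚ; 1ℚ; _+_; _≤_)
open import Data.Product using (Σ; _×_; _,_; proj₁; proj₂)
open import Function.Bundles using (_↔_; Inverse)
open import Relation.Binary.PropositionalEquality using (_≡_; _≢_)

record Graph (n : ℕ) : Set where
  field
    adj    : Fin n → Fin n → Bool
    adj-sym : ∀ i j → adj i j ≡ adj j i
    adj-irr : ∀ i → adj i i ≡ false
open Graph public

anyFin : ∀ {n} → (Fin n → Bool) → Bool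
anyFin {zero}  p = false
anyFin {suc n} p = p zero ∨ anyFin (λ i → p (suc i))

sumFin : ∀ {n} → (Fin n → ℚ) → ℚ
sumFin {zero}  f = 0ℚ
sumFin {suc n} f = f zero + sumFin (λ i → f (suc i))

_=ᶠ_ : ∀ {n} → Fin n → Fin n → Bool
i =ᶠ j = toℕ i ≡ᵇ toℕ j

module _ {n : ℕ} (G : Graph n) where

  within : ℕ → Fin n → Fin n → Bool
  within zero    u w = u =ᶠ w
  within (suc k) u w = within k u w ∨ anyFin (λ v → adj G u v ∧ within k v w)

  Connected : Set
  Connected = ∀ u w → Σ ℕ (λ k → within k u w ≡ true)

-- least k < b with p k (returns b if none).
leastBelow : (ℕ → Bool) → ℕ → ℕ
leastBelow p zero    = zero
leastBelow p (suc b) = if p zero then zero else suc (leastBelow (λ k → p (suc k)) b)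

module _ {n : ℕ} (G : Graph n) where

  -- d(u,w): length of a shortest u–w path (the least k with a walk of
  -- length ≤ k; in a graph on n vertices this is < n when u,w are connected).
  dist : Fin n → Fin n → ℕ
  dist u w = leastBelow (λ k → within G k u w) n

  Edge : Set
  Edge = Σ (Fin n × Fin n) (λ xy → (proj₁ xy < proj₂ xy) × (adj G (proj₁ xy) (proj₂ xy) ≡ true))

  edgeDist : Edge → Fin n → ℕ
  edgeDist ((x , y) , _) v = dist x v ⊓ dist y v

  resolves : Edge → Edge → Fin n → Bool
  resolves e₁ e₂ v = not (edgeDist e₁ v ≡ᵇ edgeDist e₂ v)

  weightR : (Fin n → ℚ) → Edge → Edge → ℚ
  weightR g e₁ e₂ = sumFin (λ v → if resolves e₁ e₂ v then g v else 0ℚ)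

  total : (Fin n → ℚ) → ℚ
  total g = sumFin g

  IsEdgeResolving : (Fin n → ℚ) → Set
  IsEdgeResolving g =
    (∀ v → (0ℚ ≤ g v) × (g v ≤ 1ℚ)) ×
    (∀ (e₁ e₂ : Edge) → proj₁ e₁ ≢ proj₁ e₂ → 1ℚ ≤ weightR g e₁ e₂)

  FracEdgeDimIs : ℚ → Set
  FracEdgeDimIs r =
    Σ (Fin n → ℚ) (λ g → IsEdgeResolving g × (total g ≡ r)) ×
    (∀ g → IsEdgeResolving g → r ≤ total g)

pathAdj : ∀ {n} → Fin n → Fin n → Bool
pathAdj i j = (suc (toℕ i) ≡ᵇ toℕ j) ∨ (suc (toℕ j) ≡ᵇ toℕ i)

IsPath : ∀ {n} → Graph n → Set
IsPath {n} G = Σ (Fin n ↔ Fin n) (λ σ →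
  ∀ i j → adj G (Inverse.to σ i) (Inverse.to σ j) ≡ pathAdj i j)

-- If g is an edge resolving function of total weight 1, every vertex v with g(v) > 0 lies in
-- each R_e{e₁,e₂}, for otherwise g(R_e{e₁,e₂}) ≤ 1 − g(v) < 1. Conversely, the indicator of a
-- vertex lying in every R_e{e₁,e₂} is an edge resolving function of weight 1, and once G has two
-- edges no edge resolving function weighs less. So edim_f(G) = 1 iff one vertex v resolves all
-- pairs of edges. If v does, d(·,v) is injective: two vertices at distance k+1 have neighbours at
-- distance k, and the two edges so obtained are both at distance k from v. An injective distance
-- function takes each value 0, …, n−1 once, and edges join exactly the consecutive values, so G
-- is P_n. In P_n an end vertex resolves all edges, as an edge is determined by its nearer end.
{-# OPTIONS --safe #-}
module Submission where

open import Defs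
open import Data.Nat as ℕ
  using (ℕ; zero; suc; _⊓_; _≤_; _<_; _≥_; s≤s; z<s; _≤′_; ≤′-refl; ≤′-step)
import Data.Nat.Properties as ℕₚ
open import Data.Fin using (Fin; zero; suc; toℕ; fromℕ<; punchOut)
import Data.Fin.Properties as Finₚ
open import Data.Bool using (Bool; true; false; _∧_; _∨_; not; if_then_else_)
open import Data.Bool.Properties using (_≟_; ¬-not; not-injective; ⇔→≡)
open import Data.Rational as ℚ using (ℚ; 0ℚ; 1ℚ; _+_)
import Data.Rational.Properties as ℚₚ
open import Data.Product using (∃; ∃₂; _×_; _,_; proj₁; proj₂)
open import Data.Product.Properties using (≡-dec)
open import Data.Sum as Sum using (_⊎_; inj₁; inj₂)
open import Function using (_∘_; case_of_)
open import Function.Bundles using (Inverse; Equivalence; _⇔_; mk⇔; mk↔ₛ′)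
open import Function.Definitions using (Injective)
import Function.Properties.Equivalence as ⇔
open import Relation.Nullary using (¬_; Dec; yes; no; does; contradiction)
open import Relation.Nullary.Decidable using (dec-true; dec-false; decidable-stable)
open import Relation.Binary.PropositionalEquality
open import Relation.Binary.Definitions using (tri<; tri≈; tri>)

does≡true⇒ : ∀ {a} {A : Set a} (a? : Dec A) → does a? ≡ true → A
does≡true⇒ (yes a) _ = a

does≡false⇒ : ∀ {a} {A : Set a} (a? : Dec A) → does a? ≡ false → ¬ A
does≡false⇒ (no ¬a) _ = ¬a

∨-≡true⁻ : ∀ a {b} → a ∨ b ≡ true → a ≡ true ⊎ b ≡ true
∨-≡true⁻ true  _ = inj₁ refl
∨-≡true⁻ false e = inj₂ e

∨-≡trueˡ⁺ : ∀ {a} b → a ≡ true → a ∨ b ≡ true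
∨-≡trueˡ⁺ _ refl = refl

∨-≡trueʳ⁺ : ∀ a {b} → b ≡ true → a ∨ b ≡ true
∨-≡trueʳ⁺ true  _ = refl
∨-≡trueʳ⁺ false e = e

∧-≡true⁻ : ∀ a {b} → a ∧ b ≡ true → a ≡ true × b ≡ true
∧-≡true⁻ true e = refl , e

∧-≡true⁺ : ∀ {a b} → a ≡ true → b ≡ true → a ∧ b ≡ true
∧-≡true⁺ refl e = e

anyFin-≡true⁻ : ∀ {n} (p : Fin n → Bool) → anyFin p ≡ true → ∃ λ i → p i ≡ true
anyFin-≡true⁻ {suc n} p e with ∨-≡true⁻ (p zero) e
... | inj₁ p₀ = zero , p₀
... | inj₂ ps with anyFin-≡true⁻ (p ∘ suc) ps
...   | i , pᵢ = suc i , pᵢ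

anyFin-≡true⁺ : ∀ {n} (p : Fin n → Bool) i → p i ≡ true → anyFin p ≡ true
anyFin-≡true⁺ p zero    pᵢ = ∨-≡trueˡ⁺ _ pᵢ
anyFin-≡true⁺ p (suc i) pᵢ = ∨-≡trueʳ⁺ (p zero) (anyFin-≡true⁺ (p ∘ suc) i pᵢ)

=ᶠ⇒≡ : ∀ {n} {i j : Fin n} → (i =ᶠ j) ≡ true → i ≡ j
=ᶠ⇒≡ {i = i} {j} e = Finₚ.toℕ-injective (does≡true⇒ (toℕ i ℕₚ.≟ toℕ j) e)

=ᶠ-refl : ∀ {n} (i : Fin n) → (i =ᶠ i) ≡ true
=ᶠ-refl i = dec-true (toℕ i ℕₚ.≟ toℕ i) refl

injective⇒surjective : ∀ {n} {h : Fin n → Fin n} → Injective _≡_ _≡_ h →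
                       ∀ i → ∃ λ u → h u ≡ i
injective⇒surjective {suc m} {h} h-injective i with Finₚ.any? (λ u → h u Finₚ.≟ i)
... | yes hit  = hit
... | no  miss = contradiction (Finₚ.injective⇒≤ squeeze-injective) ℕₚ.1+n≰n
  where
  i≢h : ∀ u → i ≢ h u
  i≢h u i≡hu = miss (u , sym i≡hu)

  squeeze : Fin (suc m) → Fin m
  squeeze u = punchOut (i≢h u)

  squeeze-injective : Injective _≡_ _≡_ squeeze
  squeeze-injective {u} {u′} eq = h-injective (Finₚ.punchOut-injective (i≢h u) (i≢h u′) eq)

leastBelow-≡ : ∀ p b {m} → p m ≡ true → (∀ j → j < m → p j ≡ false) → m < b →
               leastBelow p b ≡ m
leastBelow-≡ p (suc b) {zero} pₘ _ _ rewrite pₘ = refl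
leastBelow-≡ p (suc b) {suc m} pₘ below (s≤s m<b) rewrite below zero z<s =
  cong suc (leastBelow-≡ (p ∘ suc) b pₘ (λ j j<m → below (suc j) (s≤s j<m)) m<b)

Consecutive : ℕ → ℕ → Set
Consecutive a b = suc a ≡ b ⊎ suc b ≡ a

consecutive⇒≤suc : ∀ {a b} → Consecutive a b → a ≤ suc b
consecutive⇒≤suc (inj₁ refl) = ℕₚ.m≤n⇒m≤1+n (ℕₚ.n≤1+n _)
consecutive⇒≤suc (inj₂ refl) = ℕₚ.≤-refl

≤suc⇒consecutive : ∀ {a b} → a ≤ suc b → b ≤ suc a → a ≢ b → Consecutive a b
≤suc⇒consecutive {a} {b} a≤1+b b≤1+a a≢b with ℕₚ.<-cmp a b
... | tri< a<b _ _ = inj₁ (ℕₚ.≤-antisym a<b b≤1+a)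
... | tri≈ _ a≡b _ = contradiction a≡b a≢b
... | tri> _ _ b<a = inj₂ (ℕₚ.≤-antisym b<a a≤1+b)

pathAdj⇔consecutive : ∀ {n} (i j : Fin n) → pathAdj i j ≡ true ⇔ Consecutive (toℕ i) (toℕ j)
pathAdj⇔consecutive i j = mk⇔
  (Sum.map (does≡true⇒ (suc (toℕ i) ℕₚ.≟ toℕ j)) (does≡true⇒ (suc (toℕ j) ℕₚ.≟ toℕ i))
   ∘ ∨-≡true⁻ _)
  λ { (inj₁ e) → ∨-≡trueˡ⁺ _ (dec-true (suc (toℕ i) ℕₚ.≟ toℕ j) e)
    ; (inj₂ e) → ∨-≡trueʳ⁺ _ (dec-true (suc (toℕ j) ℕₚ.≟ toℕ i) e) }

_≐_ : ∀ {a} {A : Set a} → A × A → A × A → Set a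
(x , y) ≐ (x′ , y′) = (x ≡ x′ × y ≡ y′) ⊎ (x ≡ y′ × y ≡ x′)

module _ {a} {A : Set a} {x y x′ y′ : A} where

  ≐-sym : (x , y) ≐ (x′ , y′) → (x′ , y′) ≐ (x , y)
  ≐-sym (inj₁ (refl , refl)) = inj₁ (refl , refl)
  ≐-sym (inj₂ (refl , refl)) = inj₂ (refl , refl)

  ≐-trans : ∀ {x″ y″} → (x , y) ≐ (x′ , y′) → (x′ , y′) ≐ (x″ , y″) → (x , y) ≐ (x″ , y″)
  ≐-trans (inj₁ (refl , refl)) q = q
  ≐-trans (inj₂ (refl , refl)) (inj₁ (refl , refl)) = inj₂ (refl , refl)
  ≐-trans (inj₂ (refl , refl)) (inj₂ (refl , refl)) = inj₁ (refl , refl)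

  ≐-injective : ∀ {b} {B : Set b} {f : A → B} → Injective _≡_ _≡_ f →
                (f x , f y) ≐ (f x′ , f y′) → (x , y) ≐ (x′ , y′)
  ≐-injective f-inj = Sum.map (λ (p , q) → f-inj p , f-inj q) (λ (p , q) → f-inj p , f-inj q)

consecutive⇒≐⊓ : ∀ {a b} → Consecutive a b → (a , b) ≐ (a ⊓ b , suc (a ⊓ b))
consecutive⇒≐⊓ {a} (inj₁ refl) = inj₁ (sym a⊓1+a≡a , cong suc (sym a⊓1+a≡a))
  where
  a⊓1+a≡a : a ⊓ suc a ≡ a
  a⊓1+a≡a = ℕₚ.m≤n⇒m⊓n≡m (ℕₚ.n≤1+n a)
consecutive⇒≐⊓ {_} {b} (inj₂ refl) = inj₂ (cong suc (sym 1+b⊓b≡b) , sym 1+b⊓b≡b)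
  where
  1+b⊓b≡b : suc b ⊓ b ≡ b
  1+b⊓b≡b = ℕₚ.m≥n⇒m⊓n≡n (ℕₚ.n≤1+n b)

consecutive-⊓-≐ : ∀ {a b c d} → Consecutive a b → Consecutive c d → a ⊓ b ≡ c ⊓ d →
                  (a , b) ≐ (c , d)
consecutive-⊓-≐ {c = c} {d} ab cd eq =
  ≐-trans (consecutive⇒≐⊓ ab)
    (subst (λ m → (m , suc m) ≐ (c , d)) (sym eq) (≐-sym (consecutive⇒≐⊓ cd)))

module _ {n} (G : Graph n) where

  within-zero⁻ : ∀ {u w} → within G 0 u w ≡ true → u ≡ w
  within-zero⁻ = =ᶠ⇒≡

  within-refl : ∀ u → within G 0 u u ≡ true
  within-refl = =ᶠ-refl

  within-suc⁺ : ∀ k {u w} → within G k u w ≡ true → within G (suc k) u w ≡ true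
  within-suc⁺ _ = ∨-≡trueˡ⁺ _

  within-step : ∀ k {u x w} → adj G u x ≡ true → within G k x w ≡ true →
                within G (suc k) u w ≡ true
  within-step k {u} {x} {w} u~x reach = ∨-≡trueʳ⁺ (within G k u w)
    (anyFin-≡true⁺ (λ y → adj G u y ∧ within G k y w) x (∧-≡true⁺ u~x reach))

  within-suc⁻ : ∀ k {u w} → within G (suc k) u w ≡ true →
                within G k u w ≡ true ⊎ ∃ λ x → adj G u x ≡ true × within G k x w ≡ true
  within-suc⁻ k {u} {w} reach with ∨-≡true⁻ (within G k u w) reach
  ... | inj₁ near = inj₁ near
  ... | inj₂ far with anyFin-≡true⁻ _ far
  ...   | x , step = inj₂ (x , ∧-≡true⁻ (adj G u x) step)

  within-mono : ∀ {j k u w} → j ≤′ k → within G j u w ≡ true → within G k u w ≡ true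
  within-mono ≤′-refl        reach = reach
  within-mono {k = suc k} (≤′-step j≤k) reach = within-suc⁺ k (within-mono j≤k reach)

  record Shortest (k : ℕ) (u w : Fin n) : Set where
    constructor shortest
    field
      reaches : within G k u w ≡ true
      minimal : ∀ j → j < k → within G j u w ≡ false

  shortest-unique : ∀ {i j u w} → Shortest i u w → Shortest j u w → i ≡ j
  shortest-unique {i} {j} (shortest reachᵢ belowᵢ) (shortest reachⱼ belowⱼ) with ℕₚ.<-cmp i j
  ... | tri< i<j _ _ = contradiction (trans (sym reachᵢ) (belowⱼ i i<j)) λ ()
  ... | tri≈ _ i≡j _ = i≡j
  ... | tri> _ _ j<i = contradiction (trans (sym reachⱼ) (belowᵢ j j<i)) λ ()

  shortest-exists : ∀ k {u w} → within G k u w ≡ true → ∃ λ m → Shortest m u w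
  shortest-exists zero reach = 0 , shortest reach λ _ ()
  shortest-exists (suc k) {u} {w} reach with within G k u w ≟ true
  ... | yes near = shortest-exists k near
  ... | no  far  = suc k , shortest reach λ j j<1+k → ¬-not λ reachⱼ →
    far (within-mono (ℕₚ.≤⇒≤′ (ℕ.s≤s⁻¹ j<1+k)) reachⱼ)

  shortest-pred : ∀ {k u w} → Shortest (suc k) u w → ∃ λ x → adj G u x ≡ true × Shortest k x w
  shortest-pred {k} (shortest reach below) with within-suc⁻ k reach
  ... | inj₁ near = contradiction (trans (sym near) (below k (ℕₚ.n<1+n k))) λ ()
  ... | inj₂ (x , u~x , far) = x , u~x , shortest far λ j j<k → ¬-not λ reachⱼ →
    contradiction (trans (sym (within-step j u~x reachⱼ)) (below (suc j) (s≤s j<k))) λ ()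

  shortest-descend : ∀ {j k u w} → j ≤′ k → Shortest k u w → ∃ λ x → Shortest j x w
  shortest-descend ≤′-refl       s = _ , s
  shortest-descend (≤′-step j≤k) s = shortest-descend j≤k (proj₂ (proj₂ (shortest-pred s)))

  -- The vertices at distance 0, …, k from w along a shortest walk are distinct, so k < n and
  -- dist (a search bounded by n that returns n when it fails) finds k.
  shortest<n : ∀ {k u w} → Shortest k u w → k < n
  shortest<n {k} {w = w} s = Finₚ.injective⇒≤ layer-injective
    where
    layer : (i : Fin (suc k)) → ∃ λ x → Shortest (toℕ i) x w
    layer i = shortest-descend (ℕₚ.≤⇒≤′ (Finₚ.toℕ≤pred[n] i)) s

    layer-injective : Injective _≡_ _≡_ (proj₁ ∘ layer)
    layer-injective {i} {j} eq = Finₚ.toℕ-injective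
      (shortest-unique (proj₂ (layer i))
                       (subst (λ x → Shortest (toℕ j) x w) (sym eq) (proj₂ (layer j))))

  dist-shortest : ∀ {k u w} → Shortest k u w → dist G u w ≡ k
  dist-shortest s@(shortest reach below) = leastBelow-≡ _ n reach below (shortest<n s)

record IsDistanceTo {n} (G : Graph n) (v : Fin n) (f : Fin n → ℕ) : Set where
  field
    root        : f v ≡ 0
    root-unique : ∀ {u} → f u ≡ 0 → u ≡ v
    adj-≤       : ∀ {u w} → adj G u w ≡ true → f u ≤ suc (f w)
    parent      : ∀ {u k} → f u ≡ suc k → ∃ λ w → adj G u w ≡ true × f w ≡ k

module _ {n} {G : Graph n} {v : Fin n} {f : Fin n → ℕ} (isDist : IsDistanceTo G v f) where
  open IsDistanceTo isDist

  within⇒≤ : ∀ k {u} → within G k u v ≡ true → f u ≤ k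
  within⇒≤ zero reach = ℕₚ.≤-reflexive (trans (cong f (within-zero⁻ G reach)) root)
  within⇒≤ (suc k) reach with within-suc⁻ G k reach
  ... | inj₁ near            = ℕₚ.m≤n⇒m≤1+n (within⇒≤ k near)
  ... | inj₂ (x , u~x , far) = ℕₚ.≤-trans (adj-≤ u~x) (s≤s (within⇒≤ k far))

  ≤⇒within : ∀ k {u} → f u ≤ k → within G k u v ≡ true
  ≤⇒within zero {u} fu≤0 =
    subst (λ x → within G 0 u x ≡ true) (root-unique (ℕₚ.n≤0⇒n≡0 fu≤0)) (within-refl G u)
  ≤⇒within (suc k) {u} fu≤1+k with f u ℕₚ.≟ suc k
  ... | no fu≢1+k = within-suc⁺ G k (≤⇒within k (ℕ.s≤s⁻¹ (ℕₚ.≤∧≢⇒< fu≤1+k fu≢1+k)))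
  ... | yes fu≡1+k with parent fu≡1+k
  ...   | w , u~w , fw≡k = within-step G k u~w (≤⇒within k (ℕₚ.≤-reflexive fw≡k))

  isDistanceTo⇒dist≡ : ∀ u → dist G u v ≡ f u
  isDistanceTo⇒dist≡ u = dist-shortest G (shortest (≤⇒within (f u) ℕₚ.≤-refl) λ j j<fu →
    ¬-not λ reachⱼ → ℕₚ.<⇒≱ j<fu (within⇒≤ j reachⱼ))

module _ {n} (G : Graph n) (connected : Connected G) (v : Fin n) where

  shortest-dist : ∀ u → Shortest G (dist G u v) u v
  shortest-dist u =
    let _ , s = shortest-exists G (proj₁ (connected u v)) (proj₂ (connected u v))
    in subst (λ m → Shortest G m u v) (sym (dist-shortest G s)) s

  dist<n : ∀ u → dist G u v < n
  dist<n u = shortest<n G (shortest-dist u)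

  dist-isDistanceTo : IsDistanceTo G v (λ u → dist G u v)
  dist-isDistanceTo = record
    { root        = dist-shortest G (shortest (within-refl G v) λ _ ())
    ; root-unique = dist≡0⇒≡
    ; adj-≤       = dist-adj-≤
    ; parent      = dist-parent
    }
    where
    dist≡0⇒≡ : ∀ {u} → dist G u v ≡ 0 → u ≡ v
    dist≡0⇒≡ {u} d≡0 = within-zero⁻ G
      (subst (λ k → within G k u v ≡ true) d≡0 (Shortest.reaches (shortest-dist u)))

    dist-adj-≤ : ∀ {u w} → adj G u w ≡ true → dist G u v ≤ suc (dist G w v)
    dist-adj-≤ {u} {w} u~w = ℕₚ.≮⇒≥ λ far → contradiction
      (trans (sym (within-step G (dist G w v) u~w (Shortest.reaches (shortest-dist w))))
             (Shortest.minimal (shortest-dist u) _ far))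
      λ ()

    dist-parent : ∀ {u k} → dist G u v ≡ suc k → ∃ λ w → adj G u w ≡ true × dist G w v ≡ k
    dist-parent {u} d≡1+k =
      let w , u~w , s = shortest-pred G (subst (λ m → Shortest G m u v) d≡1+k (shortest-dist u))
      in w , u~w , dist-shortest G s

module _ {n} (G : Graph n) where

  adj⇒≢ : ∀ {a b} → adj G a b ≡ true → a ≢ b
  adj⇒≢ {a} a~b refl = contradiction (trans (sym a~b) (adj-irr G a)) λ ()

  mkEdge : ∀ a b → adj G a b ≡ true → Edge G
  mkEdge a b a~b with Finₚ.<-cmp a b
  ... | tri< a<b _ _ = (a , b) , a<b , a~b
  ... | tri≈ _ a≡b _ = contradiction a≡b (adj⇒≢ a~b)
  ... | tri> _ _ b<a = (b , a) , b<a , trans (adj-sym G b a) a~b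

  mkEdge-ends : ∀ a b a~b → proj₁ (mkEdge a b a~b) ≐ (a , b)
  mkEdge-ends a b a~b with Finₚ.<-cmp a b
  ... | tri< _ _ _   = inj₁ (refl , refl)
  ... | tri≈ _ a≡b _ = contradiction a≡b (adj⇒≢ a~b)
  ... | tri> _ _ _   = inj₂ (refl , refl)

  mkEdge-injective : ∀ {a b c d} a~b c~d → proj₁ (mkEdge a b a~b) ≡ proj₁ (mkEdge c d c~d) →
                     (a , b) ≐ (c , d)
  mkEdge-injective {a} {b} {c} {d} a~b c~d eq =
    ≐-trans (≐-sym (mkEdge-ends a b a~b)) (subst (_≐ (c , d)) (sym eq) (mkEdge-ends c d c~d))

  mkEdge-edgeDist : ∀ a b a~b v → edgeDist G (mkEdge a b a~b) v ≡ dist G a v ⊓ dist G b v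
  mkEdge-edgeDist a b a~b v with Finₚ.<-cmp a b
  ... | tri< _ _ _   = refl
  ... | tri≈ _ a≡b _ = contradiction a≡b (adj⇒≢ a~b)
  ... | tri> _ _ _   = ℕₚ.⊓-comm (dist G b v) (dist G a v)

  mkEdge-edgeDist-parent : ∀ {a b v k} (a~b : adj G a b ≡ true) → dist G a v ≡ suc k →
                           dist G b v ≡ k → edgeDist G (mkEdge a b a~b) v ≡ k
  mkEdge-edgeDist-parent {a} {b} {v} {k} a~b da db =
    trans (mkEdge-edgeDist a b a~b v) (trans (cong₂ _⊓_ da db) (ℕₚ.m≥n⇒m⊓n≡n (ℕₚ.n≤1+n k)))

  edge-≐⇒≡ : (e₁ e₂ : Edge G) → proj₁ e₁ ≐ proj₁ e₂ → proj₁ e₁ ≡ proj₁ e₂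
  edge-≐⇒≡ _ _ (inj₁ (refl , refl)) = refl
  edge-≐⇒≡ (_ , x<y , _) (_ , y<x , _) (inj₂ (refl , refl)) = contradiction y<x (Finₚ.<-asym x<y)

  EdgeResolvingVertex : Fin n → Set
  EdgeResolvingVertex v = ∀ (e₁ e₂ : Edge G) → proj₁ e₁ ≢ proj₁ e₂ → resolves G e₁ e₂ v ≡ true

  edgeResolvingVertex⇒edgeDist-injective :
    ∀ {v} → EdgeResolvingVertex v →
    ∀ e₁ e₂ → edgeDist G e₁ v ≡ edgeDist G e₂ v → proj₁ e₁ ≡ proj₁ e₂
  edgeResolvingVertex⇒edgeDist-injective {v} v-resolving e₁ e₂ eq =
    decidable-stable (≡-dec Finₚ._≟_ Finₚ._≟_ (proj₁ e₁) (proj₁ e₂)) λ e₁≢e₂ →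
      does≡false⇒ (edgeDist G e₁ v ℕₚ.≟ edgeDist G e₂ v)
                  (not-injective (v-resolving e₁ e₂ e₁≢e₂)) eq

  edgeDist-injective⇒edgeResolvingVertex :
    ∀ {v} → (∀ e₁ e₂ → edgeDist G e₁ v ≡ edgeDist G e₂ v → proj₁ e₁ ≡ proj₁ e₂) →
    EdgeResolvingVertex v
  edgeDist-injective⇒edgeResolvingVertex {v} injective e₁ e₂ e₁≢e₂ =
    cong not (dec-false (edgeDist G e₁ v ℕₚ.≟ edgeDist G e₂ v) (e₁≢e₂ ∘ injective e₁ e₂))

module _ {n} {G : Graph n} {v : Fin n} {f : Fin n → ℕ}
         (isDist : IsDistanceTo G v f) (f-injective : Injective _≡_ _≡_ f) where
  open IsDistanceTo isDist

  adj⇔consecutive : ∀ a b → adj G a b ≡ true ⇔ Consecutive (f a) (f b)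
  adj⇔consecutive a b = mk⇔ adj⇒consecutive consecutive⇒adj
    where
    adj⇒consecutive : adj G a b ≡ true → Consecutive (f a) (f b)
    adj⇒consecutive a~b = ≤suc⇒consecutive (adj-≤ a~b) (adj-≤ (trans (adj-sym G b a) a~b))
                            (adj⇒≢ G a~b ∘ f-injective)

    consecutive⇒adj : Consecutive (f a) (f b) → adj G a b ≡ true
    consecutive⇒adj (inj₁ 1+fa≡fb) with parent (sym 1+fa≡fb)
    ... | w , b~w , fw≡fa =
      trans (adj-sym G a b) (subst (λ x → adj G b x ≡ true) (f-injective fw≡fa) b~w)
    consecutive⇒adj (inj₂ 1+fb≡fa) with parent (sym 1+fb≡fa)
    ... | w , a~w , fw≡fb = subst (λ x → adj G a x ≡ true) (f-injective fw≡fb) a~w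

  injectiveDistance⇒edgeResolvingVertex : EdgeResolvingVertex G v
  injectiveDistance⇒edgeResolvingVertex = edgeDist-injective⇒edgeResolvingVertex G same-edge
    where
    open ≡-Reasoning

    dist≡f : ∀ u → dist G u v ≡ f u
    dist≡f = isDistanceTo⇒dist≡ isDist

    same-edge : ∀ e₁ e₂ → edgeDist G e₁ v ≡ edgeDist G e₂ v → proj₁ e₁ ≡ proj₁ e₂
    same-edge e₁@((x₁ , y₁) , _ , x₁~y₁) e₂@((x₂ , y₂) , _ , x₂~y₂) eq =
      edge-≐⇒≡ G e₁ e₂ (≐-injective f-injective (consecutive-⊓-≐
        (Equivalence.to (adj⇔consecutive x₁ y₁) x₁~y₁)
        (Equivalence.to (adj⇔consecutive x₂ y₂) x₂~y₂)
        (begin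
          f x₁ ⊓ f y₁     ≡⟨ cong₂ _⊓_ (dist≡f x₁) (dist≡f y₁) ⟨
          edgeDist G e₁ v ≡⟨ eq ⟩
          edgeDist G e₂ v ≡⟨ cong₂ _⊓_ (dist≡f x₂) (dist≡f y₂) ⟩
          f x₂ ⊓ f y₂     ∎)))

  injectiveDistance⇒isPath : (∀ u → f u < n) → IsPath G
  injectiveDistance⇒isPath f<n = mk↔ₛ′ σ τ σ∘τ τ∘σ , λ i j →
    trans (adj≡pathAdj (σ i) (σ j)) (cong₂ pathAdj (τ∘σ i) (τ∘σ j))
    where
    τ : Fin n → Fin n
    τ u = fromℕ< (f<n u)

    toℕ∘τ : ∀ u → toℕ (τ u) ≡ f u
    toℕ∘τ u = Finₚ.toℕ-fromℕ< (f<n u)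

    τ-injective : Injective _≡_ _≡_ τ
    τ-injective {x} {y} eq = f-injective (trans (sym (toℕ∘τ x)) (trans (cong toℕ eq) (toℕ∘τ y)))

    σ : Fin n → Fin n
    σ i = proj₁ (injective⇒surjective τ-injective i)

    τ∘σ : ∀ i → τ (σ i) ≡ i
    τ∘σ i = proj₂ (injective⇒surjective τ-injective i)

    σ∘τ : ∀ u → σ (τ u) ≡ u
    σ∘τ u = τ-injective (τ∘σ (τ u))

    adj≡pathAdj : ∀ a b → adj G a b ≡ pathAdj (τ a) (τ b)
    adj≡pathAdj a b = ⇔→≡ (⇔.trans (adj⇔consecutive a b) (⇔.sym
      (subst₂ (λ x y → pathAdj (τ a) (τ b) ≡ true ⇔ Consecutive x y) (toℕ∘τ a) (toℕ∘τ b)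
        (pathAdj⇔consecutive (τ a) (τ b)))))

module _ {n} (G : Graph n) (connected : Connected G) {v : Fin n}
         (v-resolving : EdgeResolvingVertex G v) where
  open IsDistanceTo (dist-isDistanceTo G connected v)

  parentEdges-≐ : ∀ {u w u′ w′ k} (u~w : adj G u w ≡ true) (u′~w′ : adj G u′ w′ ≡ true) →
                  dist G u v ≡ suc k → dist G w v ≡ k → dist G u′ v ≡ suc k → dist G w′ v ≡ k →
                  (u , w) ≐ (u′ , w′)
  parentEdges-≐ {u} {w} {u′} {w′} u~w u′~w′ du dw du′ dw′ =
    mkEdge-injective G u~w u′~w′ (edgeResolvingVertex⇒edgeDist-injective G v-resolving
      (mkEdge G u w u~w) (mkEdge G u′ w′ u′~w′)
      (trans (mkEdge-edgeDist-parent G u~w du dw) (sym (mkEdge-edgeDist-parent G u′~w′ du′ dw′))))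

  dist-injective : Injective _≡_ _≡_ (λ u → dist G u v)
  dist-injective {u} {u′} du≡du′ with dist G u v in du
  ... | zero = trans (root-unique du) (sym (root-unique (sym du≡du′)))
  ... | suc k with parent du | parent (sym du≡du′)
  ...   | w , u~w , dw | w′ , u′~w′ , dw′ with parentEdges-≐ u~w u′~w′ du dw (sym du≡du′) dw′
  ...     | inj₁ (u≡u′ , _) = u≡u′
  ...     | inj₂ (u≡w′ , _) =
    contradiction (trans (sym du) (trans (cong (λ x → dist G x v) u≡w′) dw′)) ℕₚ.1+n≢n

module _ {n} (G : Graph (suc n)) (path : IsPath G) where
  open Inverse (proj₁ path) using (to; from; strictlyInverseˡ; strictlyInverseʳ)

  position : Fin (suc n) → ℕ
  position u = toℕ (from u)

  path-adj : ∀ u w → adj G u w ≡ pathAdj (from u) (from w)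
  path-adj u w = trans (cong₂ (adj G) (sym (strictlyInverseˡ u)) (sym (strictlyInverseˡ w)))
                       (proj₂ path (from u) (from w))

  to-injective : Injective _≡_ _≡_ to
  to-injective {i} {j} eq =
    trans (sym (strictlyInverseʳ i)) (trans (cong from eq) (strictlyInverseʳ j))

  position-injective : Injective _≡_ _≡_ position
  position-injective {u} {w} eq =
    trans (sym (strictlyInverseˡ u)) (trans (cong to (Finₚ.toℕ-injective eq)) (strictlyInverseˡ w))

  position-parent : ∀ {u k} → position u ≡ suc k →
                    ∃ λ w → adj G u w ≡ true × position w ≡ k
  position-parent {u} {k} pu≡1+k = to (fromℕ< k<1+n) , u~w , pw≡k
    where
    k<1+n : k < suc n
    k<1+n = ℕₚ.<-trans (ℕₚ.n<1+n k) (subst (_< suc n) pu≡1+k (Finₚ.toℕ<n (from u)))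

    pw≡k : position (to (fromℕ< k<1+n)) ≡ k
    pw≡k = trans (cong toℕ (strictlyInverseʳ (fromℕ< k<1+n))) (Finₚ.toℕ-fromℕ< k<1+n)

    u~w : adj G u (to (fromℕ< k<1+n)) ≡ true
    u~w = trans (path-adj u _) (Equivalence.from (pathAdj⇔consecutive (from u) _)
            (inj₂ (trans (cong suc pw≡k) (sym pu≡1+k))))

  position-isDistanceTo : IsDistanceTo G (to zero) position
  position-isDistanceTo = record
    { root        = cong toℕ (strictlyInverseʳ zero)
    ; root-unique = λ {u} pu≡0 →
        trans (sym (strictlyInverseˡ u)) (cong to (Finₚ.toℕ-injective {i = from u} {j = zero} pu≡0))
    ; adj-≤       = λ {u} {w} u~w → consecutive⇒≤suc
        (Equivalence.to (pathAdj⇔consecutive (from u) (from w)) (trans (sym (path-adj u w)) u~w))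
    ; parent      = position-parent
    }

path⇒twoDistinctEdges : ∀ {m} (G : Graph (suc (suc (suc m)))) → IsPath G →
                        ∃₂ λ (e₁ e₂ : Edge G) → proj₁ e₁ ≢ proj₁ e₂
path⇒twoDistinctEdges G path = mkEdge G _ _ 0~1 , mkEdge G _ _ 1~2 , distinct
  where
  open Inverse (proj₁ path) using (to)

  0~1 : adj G (to zero) (to (suc zero)) ≡ true
  0~1 = proj₂ path zero (suc zero)

  1~2 : adj G (to (suc zero)) (to (suc (suc zero))) ≡ true
  1~2 = proj₂ path (suc zero) (suc (suc zero))

  distinct : proj₁ (mkEdge G _ _ 0~1) ≢ proj₁ (mkEdge G _ _ 1~2)
  distinct eq with mkEdge-injective G 0~1 1~2 eq
  ... | inj₁ (0≡1 , _) = case to-injective G path {zero} {suc zero} 0≡1 of λ ()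
  ... | inj₂ (0≡2 , _) = case to-injective G path {zero} {suc (suc zero)} 0≡2 of λ ()

restrict : ∀ {n} → (Fin n → Bool) → (Fin n → ℚ) → Fin n → ℚ
restrict r g u = if r u then g u else 0ℚ

module _ {n} (r : Fin n → Bool) {g : Fin n → ℚ} (g≥0 : ∀ u → 0ℚ ℚ.≤ g u) where

  restrict-nonneg : ∀ u → 0ℚ ℚ.≤ restrict r g u
  restrict-nonneg u with r u
  ... | true  = g≥0 u
  ... | false = ℚₚ.≤-refl

  restrict-≤ : ∀ u → restrict r g u ℚ.≤ g u
  restrict-≤ u with r u
  ... | true  = ℚₚ.≤-refl
  ... | false = g≥0 u

restrict-true : ∀ {n} (r : Fin n → Bool) g u → r u ≡ true → restrict r g u ≡ g u
restrict-true r g u ru rewrite ru = refl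

sumFin-mono : ∀ {n} {g h : Fin n → ℚ} → (∀ u → g u ℚ.≤ h u) → sumFin g ℚ.≤ sumFin h
sumFin-mono {zero}  _   = ℚₚ.≤-refl
sumFin-mono {suc n} g≤h = ℚₚ.+-mono-≤ (g≤h zero) (sumFin-mono (g≤h ∘ suc))

sumFin-zero : ∀ n → sumFin {n} (λ _ → 0ℚ) ≡ 0ℚ
sumFin-zero zero    = refl
sumFin-zero (suc n) = trans (ℚₚ.+-identityˡ _) (sumFin-zero n)

sumFin-positive : ∀ {n} (g : Fin n → ℚ) → 0ℚ ℚ.< sumFin g → ∃ λ u → 0ℚ ℚ.< g u
sumFin-positive {n} g 0<Σg with Finₚ.any? (λ u → 0ℚ ℚₚ.<? g u)
... | yes hit  = hit
... | no  miss = contradiction (ℚₚ.<-≤-trans 0<Σg Σg≤0) (ℚₚ.<-irrefl refl)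
  where
  Σg≤0 : sumFin g ℚ.≤ 0ℚ
  Σg≤0 = subst (sumFin g ℚ.≤_) (sumFin-zero n) (sumFin-mono λ u → ℚₚ.≮⇒≥ (miss ∘ (u ,_)))

sumFin-restrict+≤ : ∀ {n} (r : Fin n → Bool) {g : Fin n → ℚ} → (∀ u → 0ℚ ℚ.≤ g u) →
                    ∀ {v} → r v ≡ false → sumFin (restrict r g) + g v ℚ.≤ sumFin g
sumFin-restrict+≤ r {g} g≥0 {zero} r₀ rewrite r₀ = begin
  (0ℚ + R) + g zero          ≡⟨ cong (_+ g zero) (ℚₚ.+-identityˡ R) ⟩
  R + g zero                 ≡⟨ ℚₚ.+-comm R (g zero) ⟩
  g zero + R                 ≤⟨ ℚₚ.+-monoʳ-≤ (g zero)
                                  (sumFin-mono (restrict-≤ (r ∘ suc) (g≥0 ∘ suc))) ⟩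
  g zero + sumFin (g ∘ suc)  ∎
  where
  open ℚₚ.≤-Reasoning

  R : ℚ
  R = sumFin (restrict (r ∘ suc) (g ∘ suc))
sumFin-restrict+≤ r {g} g≥0 {suc v} rᵥ = begin
  (restrict r g zero + R) + g (suc v)  ≡⟨ ℚₚ.+-assoc (restrict r g zero) R (g (suc v)) ⟩
  restrict r g zero + (R + g (suc v))  ≤⟨ ℚₚ.+-mono-≤ (restrict-≤ r g≥0 zero)
                                           (sumFin-restrict+≤ (r ∘ suc) (g≥0 ∘ suc) rᵥ) ⟩
  g zero + sumFin (g ∘ suc)            ∎
  where
  open ℚₚ.≤-Reasoning

  R : ℚ
  R = sumFin (restrict (r ∘ suc) (g ∘ suc))

term≤sumFin : ∀ {n} {g : Fin n → ℚ} → (∀ u → 0ℚ ℚ.≤ g u) → ∀ v → g v ℚ.≤ sumFin g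
term≤sumFin {n} {g} g≥0 v =
  subst (ℚ._≤ sumFin g) (trans (cong (_+ g v) (sumFin-zero n)) (ℚₚ.+-identityˡ (g v)))
    (sumFin-restrict+≤ (λ _ → false) g≥0 {v} refl)

indicator : ∀ {n} → Fin n → Fin n → ℚ
indicator v u = if u =ᶠ v then 1ℚ else 0ℚ

indicator-bounds : ∀ {n} (v u : Fin n) → 0ℚ ℚ.≤ indicator v u × indicator v u ℚ.≤ 1ℚ
indicator-bounds v u with u =ᶠ v
... | true  = ℚₚ.nonNegative⁻¹ 1ℚ , ℚₚ.≤-refl
... | false = ℚₚ.≤-refl , ℚₚ.nonNegative⁻¹ 1ℚ

indicator-self : ∀ {n} (v : Fin n) → indicator v v ≡ 1ℚ
indicator-self v = cong (λ b → if b then 1ℚ else 0ℚ) (=ᶠ-refl v)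

sumFin-indicator : ∀ {n} (v : Fin n) → sumFin (indicator v) ≡ 1ℚ
sumFin-indicator {suc n} zero    = trans (cong (1ℚ +_) (sumFin-zero n)) (ℚₚ.+-identityʳ 1ℚ)
sumFin-indicator         (suc v) = trans (ℚₚ.+-identityˡ _) (sumFin-indicator v)

module _ {n} (G : Graph n) where

  positiveWeight⇒edgeResolvingVertex : ∀ {g v} → IsEdgeResolving G g → total G g ≡ 1ℚ →
                                       0ℚ ℚ.< g v → EdgeResolvingVertex G v
  positiveWeight⇒edgeResolvingVertex {g} {v} (bounds , resolving) total≡1 0<gv e₁ e₂ e₁≢e₂
    with resolves G e₁ e₂ v in unresolved
  ... | true  = refl
  ... | false = contradiction (ℚₚ.<-≤-trans W<W+gv W+gv≤W) (ℚₚ.<-irrefl refl)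
    where
    open ℚₚ.≤-Reasoning

    W : ℚ
    W = weightR G g e₁ e₂

    W<W+gv : W ℚ.< W + g v
    W<W+gv = subst (ℚ._< W + g v) (ℚₚ.+-identityʳ W) (ℚₚ.+-monoʳ-< W 0<gv)

    W+gv≤W : W + g v ℚ.≤ W
    W+gv≤W = begin
      W + g v    ≤⟨ sumFin-restrict+≤ (resolves G e₁ e₂) (proj₁ ∘ bounds) unresolved ⟩
      total G g  ≡⟨ total≡1 ⟩
      1ℚ         ≤⟨ resolving e₁ e₂ e₁≢e₂ ⟩
      W          ∎

  fracEdgeDim1⇒edgeResolvingVertex : FracEdgeDimIs G 1ℚ → ∃ (EdgeResolvingVertex G)
  fracEdgeDim1⇒edgeResolvingVertex ((g , g-resolving , total≡1) , _) =
    let v , 0<gv = sumFin-positive g (subst (0ℚ ℚ.<_) (sym total≡1) (ℚₚ.positive⁻¹ 1ℚ))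
    in v , positiveWeight⇒edgeResolvingVertex g-resolving total≡1 0<gv

  1≤total : (∃₂ λ (e₁ e₂ : Edge G) → proj₁ e₁ ≢ proj₁ e₂) →
            ∀ g → IsEdgeResolving G g → 1ℚ ℚ.≤ total G g
  1≤total (e₁ , e₂ , e₁≢e₂) g (bounds , resolving) =
    ℚₚ.≤-trans (resolving e₁ e₂ e₁≢e₂)
               (sumFin-mono (restrict-≤ (resolves G e₁ e₂) (proj₁ ∘ bounds)))

  indicator-edgeResolving : ∀ {v} → EdgeResolvingVertex G v → IsEdgeResolving G (indicator v)
  indicator-edgeResolving {v} v-resolving = indicator-bounds v , λ e₁ e₂ e₁≢e₂ →
    subst (ℚ._≤ weightR G (indicator v) e₁ e₂)
      (trans (restrict-true (resolves G e₁ e₂) (indicator v) v (v-resolving e₁ e₂ e₁≢e₂))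
             (indicator-self v))
      (term≤sumFin (restrict-nonneg (resolves G e₁ e₂) (proj₁ ∘ indicator-bounds v)) v)

  edgeResolvingVertex⇒fracEdgeDim1 : (∃₂ λ (e₁ e₂ : Edge G) → proj₁ e₁ ≢ proj₁ e₂) →
                                     ∀ {v} → EdgeResolvingVertex G v → FracEdgeDimIs G 1ℚ
  edgeResolvingVertex⇒fracEdgeDim1 twoEdges {v} v-resolving =
    (indicator v , indicator-edgeResolving v-resolving , sumFin-indicator v) , 1≤total twoEdges

mainTheorem8 : (n : ℕ) → n ≥ 3 → (G : Graph n) → Connected G →
    (FracEdgeDimIs G 1ℚ ⇔ IsPath G)
mainTheorem8 (suc zero)       (s≤s ())       _ _
mainTheorem8 (suc (suc zero)) (s≤s (s≤s ())) _ _
mainTheorem8 (suc (suc (suc m))) _ G connected = mk⇔ dim1⇒path path⇒dim1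
  where
  dim1⇒path : FracEdgeDimIs G 1ℚ → IsPath G
  dim1⇒path dim1 =
    let v , v-resolving = fracEdgeDim1⇒edgeResolvingVertex G dim1
    in injectiveDistance⇒isPath (dist-isDistanceTo G connected v)
                                (dist-injective G connected v-resolving)
                                (dist<n G connected v)

  path⇒dim1 : IsPath G → FracEdgeDimIs G 1ℚ
  path⇒dim1 path = edgeResolvingVertex⇒fracEdgeDim1 G (path⇒twoDistinctEdges G path)
    (injectiveDistance⇒edgeResolvingVertex (position-isDistanceTo G path)
                                           (position-injective G path))
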